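{- Consider an $(r:c)$-biased game on $E(K_n)$ between a random player \texttt{RP}, who claims $r$ edges per turn, and a clever player \texttt{CP}, who claims $c$ edges per turn (with a fixed rule as to who moves first). For every strategy $S$ of \texttt{CP} the following holds: for every $m\le\binom{n}{2}$ and every sequence $\Gamma=(\Gamma_1,\dots,\Gamma_m)$ of distinct edges of $K_n$, the probability that $\Gamma$ is the play-sequence of the game in which \texttt{CP} plays according to $S$ and \texttt{RP} claims in each move a uniformly random free edge is equal to the probability that $\Gamma$ is the play-sequence of the game in which \texttt{CP} plays according to $S$ and \texttt{RP} plays according to the random permutation strategy.
   Context: Players alternately take turns claiming free (previously unclaimed) edges of $K_n$; a strategy specifies the player's move in every possible game position and is continued until no free edges remain. The play-sequence of length $i$ is the list $(\Gamma_1,\dots,\Gamma_i)$ of the first $i$ edges claimed during the game by either player, in the order they were claimed, where a player claiming several edges in one turn claims them in succession and they are listed in that order. Given a permutation $\sigma:[\binom n2]\to E(K_n)$ of the edges, a player follows the permutation strategy $\sigma$ if in every move he scans the edges in the order $\sigma(1),\sigma(2),\dots$ and claims the first one that is free. In the random permutation strategy, the player picks $\sigma$ uniformly at random among all permutations of $E(K_n)$ at the start and then follows the permutation strategy $\sigma$. -}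

module Defs where

open import Data.Nat as ℕ using (ℕ; zero; suc; _≤_; _<_)
open import Data.Fin as Fin using (Fin)
import Data.Fin.Properties as FinP
open import Data.Bool using (Bool; true; false; if_then_else_)
open import Data.List using (allFin; List; []; _∷_; [_]; _++_; length; concatMap; map; filter; take; foldr)
open import Data.List.Membership.Propositional using (_∈_)
open import Data.List.Relation.Unary.Unique.Propositional using (Unique)
open import Data.Product using (_×_; _,_; proj₁; proj₂)
open import Data.Maybe using (Maybe; just; nothing)
open import Data.Integer using (+_)
open import Data.Rational using (ℚ; 0ℚ; 1ℚ; _+_; _*_; _/_)
open import Relation.Nullary using (¬_; Dec; yes; no; does; ¬?)
open import Relation.Binary.PropositionalEquality using (_≡_; refl)
import Data.List.Membership.DecPropositional as DecMem
import Data.List.Properties as ListP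

-- Edges of K_n: unordered pairs {lo, hi} of vertices, stored with lo < hi.

record Edge (n : ℕ) : Set where
  constructor edge
  field
    lo hi : Fin n
    .lo<hi : lo Fin.< hi

_≟E_ : ∀ {n} (e f : Edge n) → Dec (e ≡ f)
edge a b _ ≟E edge c d _ with a FinP.≟ c | b FinP.≟ d
... | yes refl | yes refl = yes refl
... | no a≢c   | _        = no λ { refl → a≢c refl }
... | yes _    | no b≢d   = no λ { refl → b≢d refl }

allEdges : (n : ℕ) → List (Edge n)
allEdges n = concatMap (λ i → concatMap (λ j → pick i j) (allFin n)) (allFin n)
  where
  pick : Fin n → Fin n → List (Edge n)
  pick i j with i FinP.<? j
  ... | yes p = [ edge i j p ]
  ... | no _  = []

module _ {n : ℕ} where
  open DecMem (_≟E_ {n}) using (_∈?_)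

  free : List (Edge n) → List (Edge n)
  free h = filter (λ e → ¬? (e ∈? h)) (allEdges n)

  firstFree : List (Edge n) → List (Edge n) → Maybe (Edge n)
  firstFree [] h = nothing
  firstFree (e ∷ σ) h with e ∈? h
  ... | yes _ = firstFree σ h
  ... | no  _ = just e

data Player : Set where
  RP CP : Player

other : Player → Player
other RP = CP
other CP = RP

bias : ℕ → ℕ → Player → ℕ
bias r c RP = r
bias r c CP = c

-- turn state: (player to move, number of edges that player still claims
-- in the current turn, including the next one)
nextState : ℕ → ℕ → Player × ℕ → Player × ℕ
nextState r c (p , suc (suc k)) = p , suc k
nextState r c (p , _)           = other p , bias r c (other p)

stateAt : ℕ → ℕ → Player → ℕ → Player × ℕ
stateAt r c first zero    = first , bias r c first
stateAt r c first (suc k) = nextState r c (stateAt r c first k)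

-- the player claiming the (k+1)-st edge of the game (k edges already claimed)
owner : ℕ → ℕ → Player → ℕ → Player
owner r c first k = proj₁ (stateAt r c first k)

-- Strategies of CP: given the play-sequence so far (chronological list of
-- claimed edges), the next edge CP claims.  (A turn of c edges is claimed
-- edge by edge; the history includes CP's earlier edges of the same turn.)

CPStrategy : ℕ → Set
CPStrategy n = List (Edge n) → Edge n

LegalCP : (n r c : ℕ) → Player → CPStrategy n → Set
LegalCP n r c first S =
  ∀ (h : List (Edge n)) → Unique h → owner r c first (length h) ≡ CP →
  length h < length (allEdges n) → ¬ (S h ∈ h)

Dist : Set → Set
Dist A = List (ℚ × A)

return : ∀ {A} → A → Dist A
return a = [ (1ℚ , a) ]

_>>=_ : ∀ {A B} → Dist A → (A → Dist B) → Dist B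
d >>= f = concatMap (λ { (p , a) → map (λ { (q , b) → (p * q , b) }) (f a) }) d

uniform : ∀ {A} → List A → Dist A
uniform []         = []
uniform (x ∷ xs)   = map (λ y → ((+ 1) / suc (length xs) , y)) (x ∷ xs)

Pr : ∀ {A} {P : A → Set} → Dist A → ((a : A) → Dec (P a)) → ℚ
Pr d P? = foldr (λ { (p , a) acc → if does (P? a) then p + acc else acc }) 0ℚ d

insertions : ∀ {A : Set} → A → List A → List (List A)
insertions x []       = [ x ∷ [] ]
insertions x (y ∷ ys) = (x ∷ y ∷ ys) ∷ map (y ∷_) (insertions x ys)

permutations : ∀ {A : Set} → List A → List (List A)
permutations []       = [ [] ]
permutations (x ∷ xs) = concatMap (insertions x) (permutations xs)

-- The games.  Both run for (n choose 2) = |E(K_n)| edge claims, i.e. until no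
-- free edge remains, and return the full play-sequence (chronological).

module Games (n r c : ℕ) (first : Player) (S : CPStrategy n) where

  playRandomEdge : ℕ → List (Edge n) → Dist (List (Edge n))
  playRandomEdge zero    h = return h
  playRandomEdge (suc k) h with owner r c first (length h)
  ... | CP = playRandomEdge k (h ++ [ S h ])
  ... | RP = uniform (free h) >>= λ e → playRandomEdge k (h ++ [ e ])

  gameRandomEdge : Dist (List (Edge n))
  gameRandomEdge = playRandomEdge (length (allEdges n)) []

  playPerm : List (Edge n) → ℕ → List (Edge n) → List (Edge n)
  playPerm σ zero    h = h
  playPerm σ (suc k) h with owner r c first (length h)
  ... | CP = playPerm σ k (h ++ [ S h ])
  ... | RP with firstFree σ h
  ...   | just e  = playPerm σ k (h ++ [ e ])
  ...   | nothing = h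

  gameRandomPerm : Dist (List (Edge n))
  gameRandomPerm = uniform (permutations (allEdges n)) >>= λ σ →
                   return (playPerm σ (length (allEdges n)) [])

_≟Seq_ : ∀ {n} (xs ys : List (Edge n)) → Dec (xs ≡ ys)
_≟Seq_ = ListP.≡-dec _≟E_

-- Both games let CP play the same strategy S, so only RP's edges need comparing.  Average the
-- permutation game over a uniformly random order σ of the edges that are still free.  When RP
-- moves, the first free edge of σ is its head, which is uniformly distributed, and the rest of σ
-- is a uniformly random order of the remaining free edges.  When CP claims s, deleting s from σ
-- does not change the rest of the play, and σ with s deleted is again a uniformly random order of
-- the remaining free edges.

module Submission where

open import Defs
open import Data.Nat as ℕ using (ℕ; zero; suc; _≤_; _<_)
import Data.Nat.Properties as ℕ
import Data.Nat.Coprimality as Coprime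
open import Data.Nat.Combinatorics using (_C_)
import Data.Integer as ℤ
import Data.Integer.Properties as ℤ
open import Data.Rational using (ℚ; mkℚ; 0ℚ; 1ℚ; _+_; _*_; _/_; 1/_)
open import Data.Rational.Properties
open import Data.Bool using (Bool; true; false)
open import Data.Fin as Fin using (Fin)
import Data.Fin.Properties as Fin
open import Data.List using (List; []; _∷_; [_]; _++_; length; map; concatMap; filter; drop; take; allFin)
open import Data.List.Properties using (length-++; concatMap-cong; filter-all; filter-accept; filter-reject)
open import Data.List.Membership.Propositional using (_∈_; _∉_; find)
open import Data.List.Membership.Propositional.Properties
  using (∈-filter⁺; ∈-filter⁻; ∈-concatMap⁺; ∈-concatMap⁻; ∈-map⁻; ∈-allFin)
open import Data.List.Membership.Propositional.Properties using (∈-++⁺ˡ; ∈-++⁺ʳ; ∈-++⁻)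
import Data.List.Membership.DecPropositional as DecMembership
open import Data.List.Relation.Unary.Any as Any using (here; there)
open import Data.List.Relation.Unary.All as All using ([])
open import Data.List.Relation.Unary.All.Properties using (All¬⇒¬Any)
open import Data.List.Relation.Unary.AllPairs using ([]; _∷_)
open import Data.List.Relation.Unary.Unique.Propositional using (Unique)
import Data.List.Relation.Unary.Unique.Propositional.Properties as Unique
open import Data.Maybe using (just; nothing)
open import Data.Product using (_×_; _,_; proj₁; proj₂; ∃)
open import Data.Sum using (_⊎_; inj₁; inj₂; [_,_]′)
import Data.Sum as Sum
open import Data.Empty using (⊥; ⊥-elim)
import Data.Empty.Irrelevant as Irrelevant
open import Function using (_∘_)
open import Relation.Nullary using (Dec; yes; no; ¬?; does)
open import Relation.Binary.Definitions using (DecidableEquality)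
open import Relation.Binary.PropositionalEquality
  using (_≡_; _≢_; refl; sym; trans; cong; cong₂; subst; module ≡-Reasoning)
open import Algebra.Bundles using (CommutativeMonoid)
open import Algebra.Properties.CommutativeSemigroup
  (CommutativeMonoid.commutativeSemigroup +-0-commutativeMonoid) using (interchange)

open ≡-Reasoning

private variable
  A B : Set

fromℕ : ℕ → ℚ
fromℕ m = mkℚ (ℤ.+ m) 0 (Coprime.sym (Coprime.1-coprimeTo m))

fromℕ-suc : ∀ m → fromℕ (suc m) ≡ 1ℚ + fromℕ m
fromℕ-suc m = begin
  fromℕ (suc m)  ≡⟨ sym (normalize-coprime (Coprime.sym (Coprime.1-coprimeTo (suc m)))) ⟩
  ℤ.+ suc m / 1  ≡⟨ cong (λ i → (ℤ.+ 1 ℤ.+ i) / 1) (sym (ℤ.*-identityʳ (ℤ.+ m))) ⟩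
  1ℚ + fromℕ m   ∎

fromℕ-suc-*-weight : ∀ k → fromℕ (suc k) * (ℤ.+ 1 / suc k) ≡ 1ℚ
fromℕ-suc-*-weight k = trans (cong (fromℕ (suc k) *_) (normalize-coprime (Coprime.1-coprimeTo (suc k))))
                             (*-inverseʳ (fromℕ (suc k)))

fromℕ-suc-*-cancelˡ : ∀ k {p q} → fromℕ (suc k) * p ≡ fromℕ (suc k) * q → p ≡ q
fromℕ-suc-*-cancelˡ k {p} {q} eq = begin
  p                  ≡⟨ sym (*-identityˡ p) ⟩
  1ℚ * p             ≡⟨ cong (_* p) (sym (*-inverseˡ n)) ⟩
  (1/ n * n) * p     ≡⟨ *-assoc (1/ n) n p ⟩
  1/ n * (n * p)     ≡⟨ cong (1/ n *_) eq ⟩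
  1/ n * (n * q)     ≡⟨ sym (*-assoc (1/ n) n q) ⟩
  (1/ n * n) * q     ≡⟨ cong (_* q) (*-inverseˡ n) ⟩
  1ℚ * q             ≡⟨ *-identityˡ q ⟩
  q                  ∎
  where n = fromℕ (suc k)

∑ : List A → (A → ℚ) → ℚ
∑ []       f = 0ℚ
∑ (x ∷ xs) f = f x + ∑ xs f

lengthℚ : List A → ℚ
lengthℚ xs = fromℕ (length xs)

∑-++ : ∀ (xs ys : List A) f → ∑ (xs ++ ys) f ≡ ∑ xs f + ∑ ys f
∑-++ []       ys f = sym (+-identityˡ _)
∑-++ (x ∷ xs) ys f = trans (cong (f x +_) (∑-++ xs ys f)) (sym (+-assoc (f x) _ _))

∑-map : ∀ (g : A → B) xs f → ∑ (map g xs) f ≡ ∑ xs (f ∘ g)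
∑-map g []       f = refl
∑-map g (x ∷ xs) f = cong (f (g x) +_) (∑-map g xs f)

∑-concatMap : ∀ (g : A → List B) xs f → ∑ (concatMap g xs) f ≡ ∑ xs (λ x → ∑ (g x) f)
∑-concatMap g []       f = refl
∑-concatMap g (x ∷ xs) f = trans (∑-++ (g x) (concatMap g xs) f) (cong (∑ (g x) f +_) (∑-concatMap g xs f))

∑-cong : ∀ (xs : List A) {f g} → (∀ x → x ∈ xs → f x ≡ g x) → ∑ xs f ≡ ∑ xs g
∑-cong []       eq = refl
∑-cong (x ∷ xs) eq = cong₂ _+_ (eq x (here refl)) (∑-cong xs (λ y y∈ → eq y (there y∈)))

∑-+ : ∀ (xs : List A) f g → ∑ xs (λ x → f x + g x) ≡ ∑ xs f + ∑ xs g
∑-+ []       f g = sym (+-identityˡ 0ℚ)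
∑-+ (x ∷ xs) f g = trans (cong (f x + g x +_) (∑-+ xs f g)) (interchange (f x) (g x) (∑ xs f) (∑ xs g))

*-distribˡ-∑ : ∀ p (xs : List A) f → p * ∑ xs f ≡ ∑ xs (λ x → p * f x)
*-distribˡ-∑ p []       f = *-zeroʳ p
*-distribˡ-∑ p (x ∷ xs) f = trans (*-distribˡ-+ p (f x) _) (cong (p * f x +_) (*-distribˡ-∑ p xs f))

∑-const : ∀ (xs : List A) p → ∑ xs (λ _ → p) ≡ lengthℚ xs * p
∑-const []       p = sym (*-zeroˡ p)
∑-const (x ∷ xs) p = begin
  p + ∑ xs (λ _ → p)          ≡⟨ cong₂ _+_ (sym (*-identityˡ p)) (∑-const xs p) ⟩
  1ℚ * p + lengthℚ xs * p     ≡⟨ sym (*-distribʳ-+ p 1ℚ (lengthℚ xs)) ⟩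
  (1ℚ + lengthℚ xs) * p       ≡⟨ cong (_* p) (sym (fromℕ-suc (length xs))) ⟩
  lengthℚ (x ∷ xs) * p        ∎

∑-1 : ∀ (xs : List A) → ∑ xs (λ _ → 1ℚ) ≡ lengthℚ xs
∑-1 xs = trans (∑-const xs 1ℚ) (*-identityʳ (lengthℚ xs))

*-cancelˡ-lengthℚ : ∀ {x : A} {xs p q} → x ∈ xs → lengthℚ xs * p ≡ lengthℚ xs * q → p ≡ q
*-cancelˡ-lengthℚ {xs = _ ∷ xs} _ = fromℕ-suc-*-cancelˡ (length xs)

𝔼 : Dist A → (A → ℚ) → ℚ
𝔼 d f = ∑ d (λ pa → proj₁ pa * f (proj₂ pa))

𝔼-cong : ∀ (d : Dist A) {f g} → (∀ a → f a ≡ g a) → 𝔼 d f ≡ 𝔼 d g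
𝔼-cong d eq = ∑-cong d (λ pa _ → cong (proj₁ pa *_) (eq (proj₂ pa)))

𝔼-return : ∀ (a : A) f → 𝔼 (return a) f ≡ f a
𝔼-return a f = trans (+-identityʳ _) (*-identityˡ (f a))

𝔼-bind : ∀ (d : Dist A) (k : A → Dist B) f → 𝔼 (d >>= k) f ≡ 𝔼 d (λ a → 𝔼 (k a) f)
𝔼-bind []            k f = refl
𝔼-bind ((p , a) ∷ d) k f = begin
  𝔼 (map _ (k a) ++ (d >>= k)) f
    ≡⟨ ∑-++ (map _ (k a)) (d >>= k) _ ⟩
  𝔼 (map _ (k a)) f + 𝔼 (d >>= k) f
    ≡⟨ cong₂ _+_ scaled (𝔼-bind d k f) ⟩
  p * 𝔼 (k a) f + 𝔼 d (λ a → 𝔼 (k a) f)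
    ∎
  where
  -- the map is the rescaling λ { (q , b) → (p * q , b) } inside _>>=_
  scaled : 𝔼 (map _ (k a)) f ≡ p * 𝔼 (k a) f
  scaled = begin
    𝔼 (map _ (k a)) f                       ≡⟨ ∑-map _ (k a) _ ⟩
    ∑ (k a) (λ { (q , b) → p * q * f b })   ≡⟨ ∑-cong (k a) (λ { (q , b) _ → *-assoc p q (f b) }) ⟩
    ∑ (k a) (λ { (q , b) → p * (q * f b) }) ≡⟨ sym (*-distribˡ-∑ p (k a) _) ⟩
    p * 𝔼 (k a) f                           ∎

lengthℚ-*-𝔼-uniform : ∀ (xs : List A) f → lengthℚ xs * 𝔼 (uniform xs) f ≡ ∑ xs f
lengthℚ-*-𝔼-uniform []       f = *-zeroˡ 0ℚ
lengthℚ-*-𝔼-uniform (x ∷ xs) f = begin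
  n * 𝔼 (uniform (x ∷ xs)) f     ≡⟨ cong (n *_) (∑-map (w ,_) (x ∷ xs) (λ (p , a) → p * f a)) ⟩
  n * ∑ (x ∷ xs) (λ y → w * f y) ≡⟨ cong (n *_) (sym (*-distribˡ-∑ w (x ∷ xs) f)) ⟩
  n * (w * ∑ (x ∷ xs) f)         ≡⟨ sym (*-assoc n w _) ⟩
  (n * w) * ∑ (x ∷ xs) f         ≡⟨ cong (_* ∑ (x ∷ xs) f) (fromℕ-suc-*-weight (length xs)) ⟩
  1ℚ * ∑ (x ∷ xs) f              ≡⟨ *-identityˡ _ ⟩
  ∑ (x ∷ xs) f                   ∎
  where
  n = lengthℚ (x ∷ xs)
  w = ℤ.+ 1 / suc (length xs)

indicator : Bool → ℚ
indicator true  = 1ℚ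
indicator false = 0ℚ

Pr≡𝔼-indicator : ∀ {P : A → Set} (d : Dist A) (P? : ∀ a → Dec (P a)) →
                 Pr d P? ≡ 𝔼 d (λ a → indicator (does (P? a)))
Pr≡𝔼-indicator []            P? = refl
Pr≡𝔼-indicator ((p , a) ∷ d) P? with does (P? a)
... | true  = cong₂ _+_ (sym (*-identityʳ p)) (Pr≡𝔼-indicator d P?)
... | false = trans (Pr≡𝔼-indicator d P?) (sym (trans (cong (_+ 𝔼 d _) (*-zeroʳ p)) (+-identityˡ _)))

module Permutations {A : Set} (_≟_ : DecidableEquality A) where

  ∈⇒≢[] : ∀ {x : A} {xs} → x ∈ xs → xs ≢ []
  ∈⇒≢[] (here _)  ()
  ∈⇒≢[] (there _) ()

  delete : A → List A → List A
  delete x = filter (λ y → ¬? (y ≟ x))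

  delete-∷ : ∀ x xs → delete x (x ∷ xs) ≡ delete x xs
  delete-∷ x xs = filter-reject (λ y → ¬? (y ≟ x)) (λ x≢x → x≢x refl)

  delete-∷-≢ : ∀ {x y} xs → x ≢ y → delete y (x ∷ xs) ≡ x ∷ delete y xs
  delete-∷-≢ {y = y} xs = filter-accept (λ z → ¬? (z ≟ y))

  delete-∉ : ∀ {x} xs → x ∉ xs → delete x xs ≡ xs
  delete-∉ xs x∉xs = filter-all _ (All.tabulate (λ { y∈xs refl → x∉xs y∈xs }))

  delete-∷-∉ : ∀ {x} xs → x ∉ xs → delete x (x ∷ xs) ≡ xs
  delete-∷-∉ {x} xs x∉xs = trans (delete-∷ x xs) (delete-∉ xs x∉xs)

  delete-comm : ∀ x y xs → delete x (delete y xs) ≡ delete y (delete x xs)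
  delete-comm x y []       = refl
  delete-comm x y (z ∷ xs) = by-cases (z ≟ x) (z ≟ y)
    where
    by-cases : Dec (z ≡ x) → Dec (z ≡ y) → delete x (delete y (z ∷ xs)) ≡ delete y (delete x (z ∷ xs))
    by-cases (yes refl) (yes refl) = refl
    by-cases (yes refl) (no z≢y)   = begin
      delete z (delete y (z ∷ xs)) ≡⟨ cong (delete z) (delete-∷-≢ xs z≢y) ⟩
      delete z (z ∷ delete y xs)   ≡⟨ delete-∷ z (delete y xs) ⟩
      delete z (delete y xs)       ≡⟨ delete-comm z y xs ⟩
      delete y (delete z xs)       ≡⟨ cong (delete y) (delete-∷ z xs) ⟨
      delete y (delete z (z ∷ xs)) ∎
    by-cases (no z≢x)   (yes refl) = begin
      delete x (delete z (z ∷ xs)) ≡⟨ cong (delete x) (delete-∷ z xs) ⟩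
      delete x (delete z xs)       ≡⟨ delete-comm x z xs ⟩
      delete z (delete x xs)       ≡⟨ delete-∷ z (delete x xs) ⟨
      delete z (z ∷ delete x xs)   ≡⟨ cong (delete z) (delete-∷-≢ xs z≢x) ⟨
      delete z (delete x (z ∷ xs)) ∎
    by-cases (no z≢x)   (no z≢y)   = begin
      delete x (delete y (z ∷ xs)) ≡⟨ cong (delete x) (delete-∷-≢ xs z≢y) ⟩
      delete x (z ∷ delete y xs)   ≡⟨ delete-∷-≢ (delete y xs) z≢x ⟩
      z ∷ delete x (delete y xs)   ≡⟨ cong (z ∷_) (delete-comm x y xs) ⟩
      z ∷ delete y (delete x xs)   ≡⟨ delete-∷-≢ (delete x xs) z≢y ⟨
      delete y (z ∷ delete x xs)   ≡⟨ cong (delete y) (delete-∷-≢ xs z≢x) ⟨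
      delete y (delete x (z ∷ xs)) ∎

  Unique-delete : ∀ x {xs} → Unique xs → Unique (delete x xs)
  Unique-delete x = Unique.filter⁺ (λ y → ¬? (y ≟ x))

  ∈-delete⁺ : ∀ {x y xs} → x ∈ xs → x ≢ y → x ∈ delete y xs
  ∈-delete⁺ {y = y} = ∈-filter⁺ (λ z → ¬? (z ≟ y))

  ∈-delete⁻ : ∀ {x y} xs → x ∈ delete y xs → x ∈ xs × x ≢ y
  ∈-delete⁻ {y = y} xs = ∈-filter⁻ (λ z → ¬? (z ≟ y)) {xs = xs}

  length-delete : ∀ {x xs} → Unique xs → x ∈ xs → length xs ≡ suc (length (delete x xs))
  length-delete {xs = x ∷ xs} (x≢xs ∷ _) (here refl) =
    cong (suc ∘ length) (sym (delete-∷-∉ xs (All¬⇒¬Any x≢xs)))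
  length-delete {x} {z ∷ xs} (z≢xs ∷ u) (there x∈xs) =
    trans (cong suc (length-delete u x∈xs))
          (cong (suc ∘ length) (sym (delete-∷-≢ {z} {x} xs (All.lookup z≢xs x∈xs))))

  lengthℚ-delete : ∀ {x xs} → Unique xs → x ∈ xs → lengthℚ xs ≡ 1ℚ + lengthℚ (delete x xs)
  lengthℚ-delete u x∈xs = trans (cong fromℕ (length-delete u x∈xs)) (fromℕ-suc _)

  ∑-delete : ∀ {y xs} → Unique xs → y ∈ xs → ∀ f → ∑ xs f ≡ f y + ∑ (delete y xs) f
  ∑-delete {xs = x ∷ xs} (x≢xs ∷ _) (here refl) f =
    cong (λ l → f x + ∑ l f) (sym (delete-∷-∉ xs (All¬⇒¬Any x≢xs)))
  ∑-delete {y} {x ∷ xs} (x≢xs ∷ u) (there y∈xs) f = begin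
    f x + ∑ xs f                    ≡⟨ cong (f x +_) (∑-delete u y∈xs f) ⟩
    f x + (f y + ∑ (delete y xs) f) ≡⟨ sym (+-assoc (f x) (f y) _) ⟩
    (f x + f y) + ∑ (delete y xs) f ≡⟨ cong (_+ ∑ (delete y xs) f) (+-comm (f x) (f y)) ⟩
    (f y + f x) + ∑ (delete y xs) f ≡⟨ +-assoc (f y) (f x) _ ⟩
    f y + ∑ (x ∷ delete y xs) f     ≡⟨ cong (λ l → f y + ∑ l f) x∷xs∖y ⟨
    f y + ∑ (delete y (x ∷ xs)) f   ∎
    where x∷xs∖y = delete-∷-≢ xs (All.lookup x≢xs y∈xs)

  Unique-⊆⇒length-≤ : ∀ {xs ys : List A} → Unique xs → Unique ys →
                      (∀ {x} → x ∈ xs → x ∈ ys) → length xs ≤ length ys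
  Unique-⊆⇒length-≤ {[]}     _           _  _  = ℕ.z≤n
  Unique-⊆⇒length-≤ {x ∷ xs} {ys} (x≢xs ∷ ux) uy xs⊆ys =
    ℕ.≤-trans (ℕ.s≤s (Unique-⊆⇒length-≤ ux (Unique-delete x uy) xs⊆ys-x))
              (ℕ.≤-reflexive (sym (length-delete uy (xs⊆ys (here refl)))))
    where
    xs⊆ys-x : ∀ {z} → z ∈ xs → z ∈ delete x ys
    xs⊆ys-x z∈xs = ∈-delete⁺ (xs⊆ys (there z∈xs)) (λ { refl → All.lookup x≢xs z∈xs refl })

  insertions-head : ∀ (x : A) τ → x ∷ τ ∈ insertions x τ
  insertions-head x []      = here refl
  insertions-head x (_ ∷ _) = here refl

  ∈-insertions⁻ : ∀ {x z : A} {ι} τ → ι ∈ insertions x τ → z ∈ ι → z ≡ x ⊎ z ∈ τ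
  ∈-insertions⁻ []      (here refl) (here z≡x) = inj₁ z≡x
  ∈-insertions⁻ (y ∷ τ) (here refl) (here z≡x) = inj₁ z≡x
  ∈-insertions⁻ (y ∷ τ) (here refl) (there z∈) = inj₂ z∈
  ∈-insertions⁻ (y ∷ τ) (there ι∈)  z∈ with ∈-map⁻ (y ∷_) ι∈
  ... | ι , ι∈ , refl with z∈
  ...   | here z≡y  = inj₂ (here z≡y)
  ...   | there z∈ι = Sum.map₂ there (∈-insertions⁻ τ ι∈ z∈ι)

  ∈-permutations⁻ : ∀ {z : A} {σ} xs → σ ∈ permutations xs → z ∈ σ → z ∈ xs
  ∈-permutations⁻ []       (here refl) ()
  ∈-permutations⁻ (x ∷ xs) σ∈ z∈σ with find (∈-concatMap⁻ (insertions x) {xs = permutations xs} σ∈)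
  ... | τ , τ∈ , σ∈ins = [ here , there ∘ ∈-permutations⁻ xs τ∈ ]′ (∈-insertions⁻ τ σ∈ins z∈σ)

  ∈-permutations-self : ∀ (xs : List A) → xs ∈ permutations xs
  ∈-permutations-self []       = here refl
  ∈-permutations-self (x ∷ xs) =
    ∈-concatMap⁺ (insertions x) (Any.map (λ { refl → insertions-head x xs }) (∈-permutations-self xs))

  ∑-permutations : ∀ {xs : List A} → Unique xs → (g : List A → ℚ) → (xs ≡ [] → g [] ≡ 0ℚ) →
    ∑ (permutations xs) g ≡ ∑ xs (λ x → ∑ (permutations (delete x xs)) (λ τ → g (x ∷ τ)))
  ∑-permutations {[]}     _           g g[]≡0 = trans (+-identityʳ (g [])) (g[]≡0 refl)
  ∑-permutations {x ∷ xs} (x≢xs ∷ u) g _     = begin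
    ∑ (concatMap (insertions x) (permutations xs)) g
      ≡⟨ ∑-concatMap (insertions x) (permutations xs) g ⟩
    ∑ (permutations xs) (λ τ → ∑ (insertions x τ) g)
      ≡⟨ ∑-cong (permutations xs) (λ τ _ → first+later τ) ⟩
    ∑ (permutations xs) (λ τ → g (x ∷ τ) + later τ)
      ≡⟨ ∑-+ (permutations xs) _ later ⟩
    ∑ (permutations xs) (λ τ → g (x ∷ τ)) + ∑ (permutations xs) later
      ≡⟨ cong₂ _+_ (cong (λ l → ∑ (permutations l) (λ τ → g (x ∷ τ)))
                         (sym (delete-∷-∉ xs (All¬⇒¬Any x≢xs))))
                   (∑-permutations u later (λ _ → refl)) ⟩
    ∑ (permutations (delete x (x ∷ xs))) (λ τ → g (x ∷ τ))
      + ∑ xs (λ z → ∑ (permutations (delete z xs)) (λ ρ → later (z ∷ ρ)))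
      ≡⟨ cong (∑ (permutations (delete x (x ∷ xs))) (λ τ → g (x ∷ τ)) +_)
              (∑-cong xs (λ z z∈xs → later-∑ z (All.lookup x≢xs z∈xs))) ⟩
    ∑ (permutations (delete x (x ∷ xs))) (λ τ → g (x ∷ τ))
      + ∑ xs (λ z → ∑ (permutations (delete z (x ∷ xs))) (λ τ → g (z ∷ τ)))
      ∎
    where
    -- the insertions of x that do not put x in front
    later : List A → ℚ
    later τ = ∑ (drop 1 (insertions x τ)) g

    first+later : ∀ τ → ∑ (insertions x τ) g ≡ g (x ∷ τ) + later τ
    first+later []      = refl
    first+later (_ ∷ _) = refl

    later-∑ : ∀ z → x ≢ z → ∑ (permutations (delete z xs)) (λ ρ → later (z ∷ ρ))
                          ≡ ∑ (permutations (delete z (x ∷ xs))) (λ τ → g (z ∷ τ))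
    later-∑ z x≢z = begin
      ∑ (permutations (delete z xs)) (λ ρ → ∑ (map (z ∷_) (insertions x ρ)) g)
        ≡⟨ ∑-cong (permutations (delete z xs)) (λ ρ _ → ∑-map (z ∷_) (insertions x ρ) g) ⟩
      ∑ (permutations (delete z xs)) (λ ρ → ∑ (insertions x ρ) (λ τ → g (z ∷ τ)))
        ≡⟨ ∑-concatMap (insertions x) (permutations (delete z xs)) _ ⟨
      ∑ (permutations (x ∷ delete z xs)) (λ τ → g (z ∷ τ))
        ≡⟨ cong (λ l → ∑ (permutations l) (λ τ → g (z ∷ τ))) (delete-∷-≢ xs x≢z) ⟨
      ∑ (permutations (delete z (x ∷ xs))) (λ τ → g (z ∷ τ))
        ∎

  ∑-permutations-delete : ∀ {y xs} → Unique xs → y ∈ xs → (g : List A → ℚ) →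
    ∑ (permutations xs) (λ σ → g (delete y σ)) ≡ lengthℚ xs * ∑ (permutations (delete y xs)) g
  ∑-permutations-delete u y∈xs = go _ u y∈xs refl
    where
    go : ∀ k {y xs} → Unique xs → y ∈ xs → length xs ≡ k → (g : List A → ℚ) →
      ∑ (permutations xs) (λ σ → g (delete y σ)) ≡ lengthℚ xs * ∑ (permutations (delete y xs)) g
    go zero    {xs = x ∷ xs} _ _ ()
    go (suc k) {y} {xs}      u y∈xs |xs| g = begin
      ∑ (permutations xs) (λ σ → g (delete y σ))
        ≡⟨ ∑-permutations u _ (⊥-elim ∘ ∈⇒≢[] y∈xs) ⟩
      ∑ xs Φ
        ≡⟨ ∑-delete u y∈xs Φ ⟩
      Φ y + ∑ (delete y xs) Φ
        ≡⟨ cong₂ _+_ Φ-y (∑-cong (delete y xs) Φ-x) ⟩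
      T + ∑ (delete y xs) (λ x → c * Ψ x)
        ≡⟨ cong (T +_) (*-distribˡ-∑ c (delete y xs) Ψ) ⟨
      T + c * ∑ (delete y xs) Ψ
        ≡⟨ cong (T +_) (lengthℚ-*-∑-heads (delete y xs) (Unique-delete y u)) ⟩
      T + c * T
        ≡⟨ cong (_+ c * T) (*-identityˡ T) ⟨
      1ℚ * T + c * T
        ≡⟨ *-distribʳ-+ T 1ℚ c ⟨
      (1ℚ + c) * T
        ≡⟨ cong (_* T) (lengthℚ-delete u y∈xs) ⟨
      lengthℚ xs * T
        ∎
      where
      Φ : A → ℚ
      Φ x = ∑ (permutations (delete x xs)) (λ τ → g (delete y (x ∷ τ)))
      T = ∑ (permutations (delete y xs)) g
      c = lengthℚ (delete y xs)
      Ψ : A → ℚ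
      Ψ x = ∑ (permutations (delete x (delete y xs))) (λ τ → g (x ∷ τ))

      -- the empty case of ∑-permutations is absorbed by the factor lengthℚ [] = 0
      lengthℚ-*-∑-heads : ∀ zs → Unique zs →
        lengthℚ zs * ∑ zs (λ x → ∑ (permutations (delete x zs)) (λ τ → g (x ∷ τ)))
          ≡ lengthℚ zs * ∑ (permutations zs) g
      lengthℚ-*-∑-heads []       _ = trans (*-zeroˡ 0ℚ) (sym (*-zeroˡ (g [] + 0ℚ)))
      lengthℚ-*-∑-heads (z ∷ zs) u = cong (lengthℚ (z ∷ zs) *_) (sym (∑-permutations u g (λ ())))

      Φ-y : Φ y ≡ T
      Φ-y = ∑-cong (permutations (delete y xs)) λ τ τ∈ → cong g (delete-∷-∉ τ λ y∈τ →
        proj₂ (∈-delete⁻ xs (∈-permutations⁻ (delete y xs) τ∈ y∈τ)) refl)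

      Φ-x : ∀ x → x ∈ delete y xs → Φ x ≡ c * Ψ x
      Φ-x x x∈ = begin
        Φ x
          ≡⟨ ∑-cong (permutations (delete x xs)) (λ τ _ → cong g (delete-∷-≢ τ x≢y)) ⟩
        ∑ (permutations (delete x xs)) (λ σ → g (x ∷ delete y σ))
          ≡⟨ go k (Unique-delete x u) (∈-delete⁺ y∈xs (x≢y ∘ sym)) |xs∖x| (λ σ → g (x ∷ σ)) ⟩
        lengthℚ (delete x xs) * ∑ (permutations (delete y (delete x xs))) (λ σ → g (x ∷ σ))
          ≡⟨ cong₂ (λ m l → fromℕ m * ∑ (permutations l) (λ σ → g (x ∷ σ)))
                   (trans |xs∖x| (sym |xs∖y|)) (delete-comm y x xs) ⟩
        c * Ψ x
          ∎
        where
        x∈xs = proj₁ (∈-delete⁻ xs x∈)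
        x≢y  = proj₂ (∈-delete⁻ xs x∈)
        |xs∖x| : length (delete x xs) ≡ k
        |xs∖x| = ℕ.suc-injective (trans (sym (length-delete u x∈xs)) |xs|)
        |xs∖y| : length (delete y xs) ≡ k
        |xs∖y| = ℕ.suc-injective (trans (sym (length-delete u y∈xs)) |xs|)

  lengthℚ-permutations : ∀ {y xs} → Unique xs → y ∈ xs →
    lengthℚ (permutations xs) ≡ lengthℚ xs * lengthℚ (permutations (delete y xs))
  lengthℚ-permutations {y} {xs} u y∈xs = begin
    lengthℚ (permutations xs)
      ≡⟨ ∑-1 (permutations xs) ⟨
    ∑ (permutations xs) (λ _ → 1ℚ)
      ≡⟨ ∑-permutations-delete u y∈xs (λ _ → 1ℚ) ⟩
    lengthℚ xs * ∑ (permutations (delete y xs)) (λ _ → 1ℚ)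
      ≡⟨ cong (lengthℚ xs *_) (∑-1 (permutations (delete y xs))) ⟩
    lengthℚ xs * lengthℚ (permutations (delete y xs))
      ∎

  lengthℚ-permutations-delete : ∀ {x y xs} → Unique xs → x ∈ xs → y ∈ xs →
    lengthℚ (permutations (delete x xs)) ≡ lengthℚ (permutations (delete y xs))
  lengthℚ-permutations-delete u x∈xs y∈xs =
    *-cancelˡ-lengthℚ x∈xs (trans (sym (lengthℚ-permutations u x∈xs)) (lengthℚ-permutations u y∈xs))

Unique-concatMap : ∀ (f : A → List B) (key : B → A) → (∀ x {b} → b ∈ f x → key b ≡ x) →
  (∀ x → Unique (f x)) → ∀ {xs} → Unique xs → Unique (concatMap f xs)
Unique-concatMap f key key-f Unique-f {[]}     []           = []
Unique-concatMap f key key-f Unique-f {x ∷ xs} (x≢xs ∷ uxs) =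
  Unique.++⁺ (Unique-f x) (Unique-concatMap f key key-f Unique-f uxs) disjoint
  where
  disjoint : ∀ {b} → b ∈ f x × b ∈ concatMap f xs → ⊥
  disjoint (b∈fx , b∈rest) with find (∈-concatMap⁻ f {xs = xs} b∈rest)
  ... | y , y∈xs , b∈fy = All.lookup x≢xs y∈xs (trans (sym (key-f x b∈fx)) (key-f y b∈fy))

module _ {n : ℕ} where

  edgeIfOrdered : Fin n → Fin n → List (Edge n)
  edgeIfOrdered i j with i Fin.<? j
  ... | yes i<j = [ edge i j i<j ]
  ... | no  _   = []

  -- The list builder inside allEdges is local to its where-block; unification recovers it.
  private
    hiddenBuilder : ∃ λ (pick : Fin n → Fin n → List (Edge n)) →
                    allEdges n ≡ concatMap (λ i → concatMap (pick i) (allFin n)) (allFin n)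
    hiddenBuilder = _ , refl

    hiddenBuilder≗edgeIfOrdered : ∀ i j → proj₁ hiddenBuilder i j ≡ edgeIfOrdered i j
    hiddenBuilder≗edgeIfOrdered i j with i Fin.<? j
    ... | yes _ = refl
    ... | no  _ = refl

  edgesFrom : Fin n → List (Edge n)
  edgesFrom i = concatMap (edgeIfOrdered i) (allFin n)

  allEdges≡ : allEdges n ≡ concatMap edgesFrom (allFin n)
  allEdges≡ = trans (proj₂ hiddenBuilder)
    (concatMap-cong (λ i → concatMap-cong (hiddenBuilder≗edgeIfOrdered i) (allFin n)) (allFin n))

  ∈-edgeIfOrdered⁻ : ∀ i j {e} → e ∈ edgeIfOrdered i j → Edge.lo e ≡ i × Edge.hi e ≡ j
  ∈-edgeIfOrdered⁻ i j e∈ with i Fin.<? j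
  ∈-edgeIfOrdered⁻ i j (here refl) | yes _ = refl , refl

  ∈-edgeIfOrdered⁺ : ∀ i j .(i<j : i Fin.< j) → edge i j i<j ∈ edgeIfOrdered i j
  ∈-edgeIfOrdered⁺ i j i<j with i Fin.<? j
  ... | yes _   = here refl
  ... | no  i≮j = Irrelevant.⊥-elim (i≮j i<j)

  Unique-edgeIfOrdered : ∀ i j → Unique (edgeIfOrdered i j)
  Unique-edgeIfOrdered i j with i Fin.<? j
  ... | yes _ = [] ∷ []
  ... | no  _ = []

  ∈-edgesFrom⁻ : ∀ i {e} → e ∈ edgesFrom i → Edge.lo e ≡ i
  ∈-edgesFrom⁻ i e∈ with find (∈-concatMap⁻ (edgeIfOrdered i) {xs = allFin n} e∈)
  ... | j , _ , e∈ij = proj₁ (∈-edgeIfOrdered⁻ i j e∈ij)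

  Unique-allEdges : Unique (allEdges n)
  Unique-allEdges = subst Unique (sym allEdges≡)
    (Unique-concatMap edgesFrom Edge.lo ∈-edgesFrom⁻
      (λ i → Unique-concatMap (edgeIfOrdered i) Edge.hi (λ j e∈ → proj₂ (∈-edgeIfOrdered⁻ i j e∈))
                              (Unique-edgeIfOrdered i) (Unique.allFin⁺ n))
      (Unique.allFin⁺ n))

  ∈-allEdges : ∀ e → e ∈ allEdges n
  ∈-allEdges (edge i j i<j) = subst (edge i j i<j ∈_) (sym allEdges≡)
    (∈-concatMap⁺ edgesFrom (Any.map (λ { refl →
      ∈-concatMap⁺ (edgeIfOrdered i) (Any.map (λ { refl → ∈-edgeIfOrdered⁺ i j i<j }) (∈-allFin j)) })
      (∈-allFin i)))

module _ {n : ℕ} where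
  open DecMembership (_≟E_ {n}) using (_∈?_)
  open Permutations (_≟E_ {n})

  private
    unclaimed? : (h : List (Edge n)) (x : Edge n) → Dec (x ∉ h)
    unclaimed? h x = ¬? (x ∈? h)

  filter-unclaimed-snoc : ∀ h e L →
    filter (unclaimed? (h ++ [ e ])) L ≡ delete e (filter (unclaimed? h) L)
  filter-unclaimed-snoc h e []      = refl
  filter-unclaimed-snoc h e (z ∷ L) = by-cases (z ∈? h) (z ≟E e)
    where
    IH : filter (unclaimed? (h ++ [ e ])) L ≡ delete e (filter (unclaimed? h) L)
    IH = filter-unclaimed-snoc h e L
    by-cases : Dec (z ∈ h) → Dec (z ≡ e) →
      filter (unclaimed? (h ++ [ e ])) (z ∷ L) ≡ delete e (filter (unclaimed? h) (z ∷ L))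
    by-cases (yes z∈h) _ = begin
      filter (unclaimed? (h ++ [ e ])) (z ∷ L)
        ≡⟨ filter-reject (unclaimed? (h ++ [ e ])) (λ z∉ → z∉ (∈-++⁺ˡ z∈h)) ⟩
      filter (unclaimed? (h ++ [ e ])) L
        ≡⟨ IH ⟩
      delete e (filter (unclaimed? h) L)
        ≡⟨ cong (delete e) (filter-reject (unclaimed? h) (λ z∉ → z∉ z∈h)) ⟨
      delete e (filter (unclaimed? h) (z ∷ L))
        ∎
    by-cases (no z∉h) (yes refl) = begin
      filter (unclaimed? (h ++ [ z ])) (z ∷ L)
        ≡⟨ filter-reject (unclaimed? (h ++ [ z ])) (λ z∉ → z∉ (∈-++⁺ʳ h (here refl))) ⟩
      filter (unclaimed? (h ++ [ z ])) L
        ≡⟨ IH ⟩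
      delete z (filter (unclaimed? h) L)
        ≡⟨ delete-∷ z _ ⟨
      delete z (z ∷ filter (unclaimed? h) L)
        ≡⟨ cong (delete z) (filter-accept (unclaimed? h) z∉h) ⟨
      delete z (filter (unclaimed? h) (z ∷ L))
        ∎
    by-cases (no z∉h) (no z≢e) = begin
      filter (unclaimed? (h ++ [ e ])) (z ∷ L)
        ≡⟨ filter-accept (unclaimed? (h ++ [ e ])) z∉h++e ⟩
      z ∷ filter (unclaimed? (h ++ [ e ])) L
        ≡⟨ cong (z ∷_) IH ⟩
      z ∷ delete e (filter (unclaimed? h) L)
        ≡⟨ delete-∷-≢ _ z≢e ⟨
      delete e (z ∷ filter (unclaimed? h) L)
        ≡⟨ cong (delete e) (filter-accept (unclaimed? h) z∉h) ⟨
      delete e (filter (unclaimed? h) (z ∷ L))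
        ∎
      where
      z∉h++e : z ∉ h ++ [ e ]
      z∉h++e z∈ = [ z∉h , (λ { (here z≡e) → z≢e z≡e }) ]′ (∈-++⁻ h z∈)

  free-snoc : ∀ h e → free (h ++ [ e ]) ≡ delete e (free h)
  free-snoc h e = filter-unclaimed-snoc h e (allEdges n)

  free-[] : free [] ≡ allEdges n
  free-[] = filter-all (unclaimed? []) (All.tabulate (λ _ ()))

  Unique-free : ∀ h → Unique (free h)
  Unique-free h = Unique.filter⁺ (unclaimed? h) Unique-allEdges

  ∈-free⁺ : ∀ {x h} → x ∉ h → x ∈ free h
  ∈-free⁺ {x} {h} = ∈-filter⁺ (unclaimed? h) (∈-allEdges x)

  ∈-free⁻ : ∀ {x} h → x ∈ free h → x ∉ h
  ∈-free⁻ h x∈ = proj₂ (∈-filter⁻ (unclaimed? h) {xs = allEdges n} x∈)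

  free-nonempty : ∀ {h} → Unique h → length h < length (allEdges n) → ∃ (_∈ free h)
  free-nonempty {h} uh |h|<N with free h in eq
  ... | x ∷ _ = x , here refl
  ... | []    = ⊥-elim (ℕ.<⇒≱ |h|<N (Unique-⊆⇒length-≤ Unique-allEdges uh allEdges⊆h))
    where
    allEdges⊆h : ∀ {x} → x ∈ allEdges n → x ∈ h
    allEdges⊆h {x} _ with x ∈? h
    ... | yes x∈h = x∈h
    ... | no  x∉h = ⊥-elim (∈⇒≢[] (∈-free⁺ x∉h) eq)

  firstFree-∷-∉ : ∀ {x h} σ → x ∉ h → firstFree (x ∷ σ) h ≡ just x
  firstFree-∷-∉ {x} {h} σ x∉h with x ∈? h
  ... | yes x∈h = ⊥-elim (x∉h x∈h)
  ... | no  _   = refl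

  firstFree-∷-∈ : ∀ {x h} σ → x ∈ h → firstFree (x ∷ σ) h ≡ firstFree σ h
  firstFree-∷-∈ {x} {h} σ x∈h with x ∈? h
  ... | yes _   = refl
  ... | no  x∉h = ⊥-elim (x∉h x∈h)

  firstFree-delete : ∀ {y h} σ → y ∈ h → firstFree (delete y σ) h ≡ firstFree σ h
  firstFree-delete []      y∈h = refl
  firstFree-delete {y} {h} (x ∷ σ) y∈h with x ≟E y
  ... | yes refl = trans (firstFree-delete σ y∈h) (sym (firstFree-∷-∈ σ y∈h))
  ... | no  _ with x ∈? h
  ...   | yes _ = firstFree-delete σ y∈h
  ...   | no  _ = refl

module _ (n r c : ℕ) (first : Player) (S : CPStrategy n) where
  open Games n r c first S
  open Permutations (_≟E_ {n})

  private
    N : ℕ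
    N = length (allEdges n)

    mover : List (Edge n) → Player
    mover h = owner r c first (length h)

  playPerm-CP : ∀ σ k h → mover h ≡ CP → playPerm σ (suc k) h ≡ playPerm σ k (h ++ [ S h ])
  playPerm-CP σ k h CP-moves with owner r c first (length h)
  playPerm-CP σ k h refl | CP = refl

  playPerm-RP : ∀ σ k h {e} → mover h ≡ RP → firstFree σ h ≡ just e →
                playPerm σ (suc k) h ≡ playPerm σ k (h ++ [ e ])
  playPerm-RP σ k h RP-moves e-first with owner r c first (length h)
  playPerm-RP σ k h refl e-first | RP rewrite e-first = refl

  playRandomEdge-CP : ∀ k h → mover h ≡ CP → playRandomEdge (suc k) h ≡ playRandomEdge k (h ++ [ S h ])
  playRandomEdge-CP k h CP-moves with owner r c first (length h)
  playRandomEdge-CP k h refl | CP = refl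

  playRandomEdge-RP : ∀ k h → mover h ≡ RP →
    playRandomEdge (suc k) h ≡ (uniform (free h) >>= λ e → playRandomEdge k (h ++ [ e ]))
  playRandomEdge-RP k h RP-moves with owner r c first (length h)
  playRandomEdge-RP k h refl | RP = refl

  -- Histories only grow, so once y is claimed σ and σ′ are only ever consulted on histories containing y.
  playPerm-cong : ∀ {y} σ σ′ → (∀ h → y ∈ h → firstFree σ h ≡ firstFree σ′ h) →
                  ∀ k h → y ∈ h → playPerm σ k h ≡ playPerm σ′ k h
  playPerm-cong σ σ′ agree zero    h y∈h = refl
  playPerm-cong σ σ′ agree (suc k) h y∈h with owner r c first (length h)
  ... | CP = playPerm-cong σ σ′ agree k (h ++ [ S h ]) (∈-++⁺ˡ y∈h)
  ... | RP rewrite agree h y∈h with firstFree σ′ h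
  ...   | just e  = playPerm-cong σ σ′ agree k (h ++ [ e ]) (∈-++⁺ˡ y∈h)
  ...   | nothing = refl

  playPerm-delete : ∀ {y} σ k h → y ∈ h → playPerm (delete y σ) k h ≡ playPerm σ k h
  playPerm-delete σ = playPerm-cong (delete _ σ) σ (λ h → firstFree-delete σ)

  playPerm-∷ : ∀ {x} σ k h → x ∈ h → playPerm (x ∷ σ) k h ≡ playPerm σ k h
  playPerm-∷ σ = playPerm-cong (_ ∷ σ) σ (λ h → firstFree-∷-∈ σ)

  Unique-snoc : ∀ {h : List (Edge n)} {e} → Unique h → e ∉ h → Unique (h ++ [ e ])
  Unique-snoc uh e∉h = Unique.++⁺ uh ([] ∷ []) (λ { (e∈h , here refl) → e∉h e∈h })

  PermSumMatches : List (Edge n) → ℕ → List (Edge n) → (List (Edge n) → ℚ) → Set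
  PermSumMatches L k h g =
    ∑ (permutations L) (λ σ → g (playPerm σ k h)) ≡ lengthℚ (permutations L) * 𝔼 (playRandomEdge k h) g

  PermSumMatches-CP : ∀ {k h g} → mover h ≡ CP → S h ∉ h →
    PermSumMatches (delete (S h) (free h)) k (h ++ [ S h ]) g → PermSumMatches (free h) (suc k) h g
  PermSumMatches-CP {k} {h} {g} moves s∉h IH = begin
    ∑ (permutations F) (λ σ → g (playPerm σ (suc k) h))
      ≡⟨ ∑-cong (permutations F) (λ σ _ → cong g (trans (playPerm-CP σ k h moves) (sym (s-irrelevant σ)))) ⟩
    ∑ (permutations F) (λ σ → g (playPerm (delete s σ) k h′))
      ≡⟨ ∑-permutations-delete (Unique-free h) s∈F _ ⟩
    lengthℚ F * ∑ (permutations (delete s F)) (λ τ → g (playPerm τ k h′))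
      ≡⟨ cong (lengthℚ F *_) IH ⟩
    lengthℚ F * (lengthℚ (permutations (delete s F)) * 𝔼 (playRandomEdge k h′) g)
      ≡⟨ *-assoc (lengthℚ F) (lengthℚ (permutations (delete s F))) (𝔼 (playRandomEdge k h′) g) ⟨
    (lengthℚ F * lengthℚ (permutations (delete s F))) * 𝔼 (playRandomEdge k h′) g
      ≡⟨ cong₂ _*_ (lengthℚ-permutations (Unique-free h) s∈F)
                   (cong (λ d → 𝔼 d g) (playRandomEdge-CP k h moves)) ⟨
    lengthℚ (permutations F) * 𝔼 (playRandomEdge (suc k) h) g
      ∎
    where
    F = free h
    s = S h
    h′ = h ++ [ s ]
    s∈F = ∈-free⁺ s∉h
    s-irrelevant : ∀ σ → playPerm (delete s σ) k h′ ≡ playPerm σ k h′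
    s-irrelevant σ = playPerm-delete σ k h′ (∈-++⁺ʳ h (here refl))

  PermSumMatches-RP : ∀ {k h g x} → mover h ≡ RP → x ∈ free h →
    (∀ e → e ∈ free h → PermSumMatches (delete e (free h)) k (h ++ [ e ]) g) →
    PermSumMatches (free h) (suc k) h g
  PermSumMatches-RP {k} {h} {g} {x₀} moves x₀∈F IH = begin
    ∑ (permutations F) (λ σ → g (playPerm σ (suc k) h))
      ≡⟨ ∑-permutations (Unique-free h) _ (⊥-elim ∘ ∈⇒≢[] x₀∈F) ⟩
    ∑ F (λ x → ∑ (permutations (delete x F)) (λ τ → g (playPerm (x ∷ τ) (suc k) h)))
      ≡⟨ ∑-cong F (λ x x∈F → trans (∑-cong (permutations (delete x F)) (λ τ _ → cong g (claims x∈F τ)))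
                                   (trans (IH x x∈F) (cong (_* Ex x) (count x∈F)))) ⟩
    ∑ F (λ x → Q * Ex x)
      ≡⟨ *-distribˡ-∑ Q F Ex ⟨
    Q * ∑ F Ex
      ≡⟨ cong (Q *_) (lengthℚ-*-𝔼-uniform F Ex) ⟨
    Q * (lengthℚ F * 𝔼 (uniform F) Ex)
      ≡⟨ *-assoc Q (lengthℚ F) (𝔼 (uniform F) Ex) ⟨
    (Q * lengthℚ F) * 𝔼 (uniform F) Ex
      ≡⟨ cong (_* 𝔼 (uniform F) Ex) (*-comm Q (lengthℚ F)) ⟩
    (lengthℚ F * Q) * 𝔼 (uniform F) Ex
      ≡⟨ cong₂ _*_ (lengthℚ-permutations (Unique-free h) x₀∈F) (𝔼-bind (uniform F) _ g) ⟨
    lengthℚ (permutations F) * 𝔼 (uniform F >>= λ e → playRandomEdge k (h ++ [ e ])) g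
      ≡⟨ cong (λ d → lengthℚ (permutations F) * 𝔼 d g) (playRandomEdge-RP k h moves) ⟨
    lengthℚ (permutations F) * 𝔼 (playRandomEdge (suc k) h) g
      ∎
    where
    F = free h
    Q = lengthℚ (permutations (delete x₀ F))
    Ex : Edge n → ℚ
    Ex e = 𝔼 (playRandomEdge k (h ++ [ e ])) g
    claims : ∀ {x} → x ∈ F → ∀ τ → playPerm (x ∷ τ) (suc k) h ≡ playPerm τ k (h ++ [ x ])
    claims {x} x∈F τ = trans (playPerm-RP (x ∷ τ) k h moves (firstFree-∷-∉ τ (∈-free⁻ h x∈F)))
                             (playPerm-∷ τ k (h ++ [ x ]) (∈-++⁺ʳ h (here refl)))
    count : ∀ {x} → x ∈ F → lengthℚ (permutations (delete x F)) ≡ Q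
    count x∈F = lengthℚ-permutations-delete (Unique-free h) x∈F x₀∈F

  PermSumMatches-snoc : ∀ k h e g → PermSumMatches (free (h ++ [ e ])) k (h ++ [ e ]) g →
                        PermSumMatches (delete e (free h)) k (h ++ [ e ]) g
  PermSumMatches-snoc k h e g = subst (λ L → PermSumMatches L k (h ++ [ e ]) g) (free-snoc h e)

  private
    bound⇒< : ∀ m {k} → m ℕ.+ suc k ≤ N → m < N
    bound⇒< m = ℕ.<-≤-trans (ℕ.m<m+n m ℕ.z<s)

    bound-snoc : ∀ (h : List (Edge n)) {e k} → length h ℕ.+ suc k ≤ N → length (h ++ [ e ]) ℕ.+ k ≤ N
    bound-snoc h {e} {k} = subst (_≤ N) (sym (trans (cong (ℕ._+ k) (length-++ h)) (ℕ.+-assoc (length h) 1 k)))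

  ∑-playPerm : LegalCP n r c first S → ∀ k h → Unique h → length h ℕ.+ k ≤ N → ∀ g →
    PermSumMatches (free h) k h g
  ∑-playPerm legal zero h uh _ g =
    trans (∑-const (permutations (free h)) (g h))
          (cong (lengthℚ (permutations (free h)) *_) (sym (𝔼-return h g)))
  ∑-playPerm legal (suc k) h uh bound g = by-mover (mover h) refl
    where
    IH : ∀ {e} → e ∉ h → PermSumMatches (delete e (free h)) k (h ++ [ e ]) g
    IH {e} e∉h = PermSumMatches-snoc k h e g
      (∑-playPerm legal k (h ++ [ e ]) (Unique-snoc uh e∉h) (bound-snoc h bound) g)

    by-mover : ∀ p → mover h ≡ p → PermSumMatches (free h) (suc k) h g
    by-mover CP moves = PermSumMatches-CP {h = h} moves s∉h (IH s∉h)
      where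
      s∉h : S h ∉ h
      s∉h = legal h uh moves (bound⇒< (length h) bound)
    by-mover RP moves = PermSumMatches-RP {h = h} moves (proj₂ (free-nonempty uh (bound⇒< (length h) bound)))
                                          (λ e e∈F → IH (∈-free⁻ h e∈F))

  𝔼-gameRandomPerm : LegalCP n r c first S → ∀ φ → 𝔼 gameRandomPerm φ ≡ 𝔼 gameRandomEdge φ
  𝔼-gameRandomPerm legal φ = *-cancelˡ-lengthℚ (∈-permutations-self (allEdges n)) (begin
    lengthℚ Π * 𝔼 gameRandomPerm φ
      ≡⟨ cong (lengthℚ Π *_) (𝔼-bind (uniform Π) (λ σ → return (playPerm σ N [])) φ) ⟩
    lengthℚ Π * 𝔼 (uniform Π) (λ σ → 𝔼 (return (playPerm σ N [])) φ)
      ≡⟨ cong (lengthℚ Π *_) (𝔼-cong (uniform Π) (λ σ → 𝔼-return (playPerm σ N []) φ)) ⟩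
    lengthℚ Π * 𝔼 (uniform Π) ψ
      ≡⟨ lengthℚ-*-𝔼-uniform Π ψ ⟩
    ∑ Π ψ
      ≡⟨ subst (λ L → PermSumMatches L N [] φ) free-[] (∑-playPerm legal N [] [] ℕ.≤-refl φ) ⟩
    lengthℚ Π * 𝔼 gameRandomEdge φ
      ∎)
    where
    Π = permutations (allEdges n)
    ψ : List (Edge n) → ℚ
    ψ σ = φ (playPerm σ N [])

-- The equality holds for every event.
proposition1 : (n r c : ℕ) → 1 ≤ r → 1 ≤ c → (first : Player) →
    (S : CPStrategy n) → LegalCP n r c first S →
    (m : ℕ) → m ≤ n C 2 → (Γ : List (Edge n)) → length Γ ≡ m → Unique Γ →
    Pr (Games.gameRandomEdge n r c first S) (λ play → take m play ≟Seq Γ)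
      ≡ Pr (Games.gameRandomPerm n r c first S) (λ play → take m play ≟Seq Γ)
proposition1 n r c _ _ first S legal m _ Γ _ _ = begin
  Pr gameRandomEdge is-Γ                                   ≡⟨ Pr≡𝔼-indicator gameRandomEdge is-Γ ⟩
  𝔼 gameRandomEdge (λ play → indicator (does (is-Γ play))) ≡⟨ 𝔼-gameRandomPerm n r c first S legal _ ⟨
  𝔼 gameRandomPerm (λ play → indicator (does (is-Γ play))) ≡⟨ Pr≡𝔼-indicator gameRandomPerm is-Γ ⟨
  Pr gameRandomPerm is-Γ                                   ∎
  where
  open Games n r c first S
  is-Γ : (play : List (Edge n)) → Dec (take m play ≡ Γ)
  is-Γ play = take m play ≟Seq Γ
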